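{- The equation $x[y[x[z]]]=x[(y[x])[z]]$ holds for all partial functions $x,y,z\in\mathcal{P}(X,Y)$ (for all nonempty sets $X,Y$), but it is not a consequence of the laws $x=x[x\sqcup y]$, $x\sqcup y=y[x]\sqcup x$, $(x[y])[z]=x[z\sqcup y]$, $(x\sqcup y)[z]=x[z]\sqcup y[z]$, together with associativity and idempotence of $\sqcup$.
   Context: $\mathcal{P}(X,Y)$ is the set of partial functions from $X$ to $Y$. Override: $(f\sqcup g)(x)=f(x)$ if $x\in\mathrm{dom}(f)$, $=g(x)$ if $x\in\mathrm{dom}(g)\setminus\mathrm{dom}(f)$, undefined otherwise. Update: $f[g]$ is the restriction of $g\sqcup f$ to $\mathrm{dom}(f)$. "Not a consequence" means there is an algebra with binary operations $\sqcup$ and $\underline{\phantom{a}}[\underline{\phantom{a}}]$ satisfying the listed laws in which the given equation fails. -}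

module Defs where

open import Data.Maybe using (Maybe; just; nothing)
open import Data.Product using (Σ; _×_; ∃-syntax)
open import Relation.Binary.PropositionalEquality using (_≡_; _≢_)

PFun : Set → Set → Set
PFun X Y = X → Maybe Y

_⊔_ : {X Y : Set} → PFun X Y → PFun X Y → PFun X Y
(f ⊔ g) a with f a
... | just b  = just b
... | nothing = g a

_[_] : {X Y : Set} → PFun X Y → PFun X Y → PFun X Y
(f [ g ]) a with f a
... | nothing = nothing
... | just b  = (g ⊔ f) a

_≐_ : {X Y : Set} → PFun X Y → PFun X Y → Set
f ≐ g = ∀ a → f a ≡ g a

record Laws {A : Set} (_⊔'_ : A → A → A) (_[_]' : A → A → A) : Set where
  field
    law1     : ∀ x y → x ≡ x [ x ⊔' y ]'
    law2     : ∀ x y → x ⊔' y ≡ (y [ x ]') ⊔' x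
    law3     : ∀ x y z → (x [ y ]') [ z ]' ≡ x [ z ⊔' y ]'
    law4     : ∀ x y z → (x ⊔' y) [ z ]' ≡ (x [ z ]') ⊔' (y [ z ]')
    ⊔-assoc  : ∀ x y z → (x ⊔' y) ⊔' z ≡ x ⊔' (y ⊔' z)
    ⊔-idem   : ∀ x → x ⊔' x ≡ x

Fails : {A : Set} (_⊔'_ : A → A → A) (_[_]' : A → A → A) → Set
Fails {A} _⊔'_ _[_]' =
  ∃[ x ] ∃[ y ] ∃[ z ] (x [ y [ x [ z ]' ]' ]' ≢ x [ (y [ x ]') [ z ]' ]')

-- Override and update act pointwise, so at each point the equation becomes an
-- identity between the induced operations on Maybe Y, which holds by cases.
-- Non-derivability is witnessed by a 16-element model of the laws, checked
-- exhaustively, in which the equation fails at (x, y, z) = (0, 4, 13).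

module Submission where

open import Defs
open import Data.Product using (Σ; _×_; ∃-syntax; _,_)
open import Data.Maybe using (Maybe; just; nothing; _<∣>_)
open import Relation.Binary.PropositionalEquality using (_≡_; refl; cong; module ≡-Reasoning)
open import Data.Fin using (Fin; _≟_)
open import Data.Fin.Properties using (all?)
open import Data.Fin.Literals as Fin using ()
open import Data.Nat using (ℕ)
open import Data.Nat.Literals as ℕ using ()
open import Data.Unit using (tt)
open import Data.Vec using (Vec; lookup; []; _∷_)
open import Agda.Builtin.FromNat using (Number; fromNat)
open import Relation.Nullary.Decidable using (toWitness)

module PointwiseUpdate {X Y : Set} where

  infixl 9 _[_]ᴹ

  _[_]ᴹ : Maybe Y → Maybe Y → Maybe Y
  nothing [ n ]ᴹ = nothing
  just b  [ n ]ᴹ = n <∣> just b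

  override-at : (f g : PFun X Y) (a : X) → (f ⊔ g) a ≡ f a <∣> g a
  override-at f g a with f a
  ... | just _  = refl
  ... | nothing = refl

  update-at : (f g : PFun X Y) (a : X) → (f [ g ]) a ≡ f a [ g a ]ᴹ
  update-at f g a with f a in fa
  ... | nothing = refl
  ... | just b  rewrite override-at g f a | fa = refl

  update-identityᴹ : (p q r : Maybe Y) → p [ q [ p [ r ]ᴹ ]ᴹ ]ᴹ ≡ p [ q [ p ]ᴹ [ r ]ᴹ ]ᴹ
  update-identityᴹ nothing  q        r        = refl
  update-identityᴹ (just _) nothing  r        = refl
  update-identityᴹ (just _) (just _) nothing  = refl
  update-identityᴹ (just _) (just _) (just _) = refl

  update-identity : (x y z : PFun X Y) → (x [ y [ x [ z ] ] ]) ≐ (x [ (y [ x ]) [ z ] ])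
  update-identity x y z a = begin
    (x [ y [ x [ z ] ] ]) a           ≡⟨ update-at x _ a ⟩
    x a [ (y [ x [ z ] ]) a ]ᴹ        ≡⟨ cong (x a [_]ᴹ) (update-at y _ a) ⟩
    x a [ y a [ (x [ z ]) a ]ᴹ ]ᴹ     ≡⟨ cong (λ m → x a [ y a [ m ]ᴹ ]ᴹ) (update-at x z a) ⟩
    x a [ y a [ x a [ z a ]ᴹ ]ᴹ ]ᴹ    ≡⟨ update-identityᴹ (x a) (y a) (z a) ⟩
    x a [ y a [ x a ]ᴹ [ z a ]ᴹ ]ᴹ    ≡⟨ cong (λ m → x a [ m [ z a ]ᴹ ]ᴹ) (update-at y x a) ⟨
    x a [ (y [ x ]) a [ z a ]ᴹ ]ᴹ     ≡⟨ cong (x a [_]ᴹ) (update-at (y [ x ]) z a) ⟨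
    x a [ ((y [ x ]) [ z ]) a ]ᴹ      ≡⟨ update-at x _ a ⟨
    (x [ (y [ x ]) [ z ] ]) a         ∎
    where open ≡-Reasoning

module Counterexample where

  -- With fromNat in scope every numeral is overloaded, including the 16 in Fin 16.
  instance
    ℕ-literals : Number ℕ
    ℕ-literals = ℕ.number

    Fin16-literals : Number (Fin 16)
    Fin16-literals = Fin.number 16

  override-table : Vec (Vec (Fin 16) 16) 16
  override-table =
      ( 0 ∷  0 ∷  0 ∷  0 ∷  8 ∷  9 ∷  8 ∷  9 ∷  8 ∷  9 ∷  8 ∷  9 ∷  8 ∷  9 ∷  9 ∷  8 ∷ [])
    ∷ ( 1 ∷  1 ∷  1 ∷  1 ∷ 10 ∷ 11 ∷ 10 ∷ 11 ∷ 10 ∷ 11 ∷ 10 ∷ 11 ∷ 10 ∷ 11 ∷ 11 ∷ 10 ∷ [])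
    ∷ ( 2 ∷  2 ∷  2 ∷  2 ∷ 12 ∷ 13 ∷ 12 ∷ 13 ∷ 12 ∷ 13 ∷ 12 ∷ 13 ∷ 12 ∷ 13 ∷ 13 ∷ 12 ∷ [])
    ∷ ( 3 ∷  3 ∷  3 ∷  3 ∷ 15 ∷ 14 ∷ 15 ∷ 14 ∷ 15 ∷ 14 ∷ 15 ∷ 14 ∷ 15 ∷ 14 ∷ 14 ∷ 15 ∷ [])
    ∷ ( 8 ∷  8 ∷ 12 ∷ 12 ∷  4 ∷  4 ∷  4 ∷  4 ∷  8 ∷  8 ∷  8 ∷  8 ∷ 12 ∷ 12 ∷ 12 ∷ 12 ∷ [])
    ∷ ( 9 ∷  9 ∷ 14 ∷ 14 ∷  5 ∷  5 ∷  5 ∷  5 ∷  9 ∷  9 ∷  9 ∷  9 ∷ 14 ∷ 14 ∷ 14 ∷ 14 ∷ [])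
    ∷ (10 ∷ 10 ∷ 15 ∷ 15 ∷  6 ∷  6 ∷  6 ∷  6 ∷ 10 ∷ 10 ∷ 10 ∷ 10 ∷ 15 ∷ 15 ∷ 15 ∷ 15 ∷ [])
    ∷ (11 ∷ 11 ∷ 13 ∷ 13 ∷  7 ∷  7 ∷  7 ∷  7 ∷ 11 ∷ 11 ∷ 11 ∷ 11 ∷ 13 ∷ 13 ∷ 13 ∷ 13 ∷ [])
    ∷ ( 8 ∷  8 ∷  8 ∷  8 ∷  8 ∷  8 ∷  8 ∷  8 ∷  8 ∷  8 ∷  8 ∷  8 ∷  8 ∷  8 ∷  8 ∷  8 ∷ [])
    ∷ ( 9 ∷  9 ∷  9 ∷  9 ∷  9 ∷  9 ∷  9 ∷  9 ∷  9 ∷  9 ∷  9 ∷  9 ∷  9 ∷  9 ∷  9 ∷  9 ∷ [])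
    ∷ (10 ∷ 10 ∷ 10 ∷ 10 ∷ 10 ∷ 10 ∷ 10 ∷ 10 ∷ 10 ∷ 10 ∷ 10 ∷ 10 ∷ 10 ∷ 10 ∷ 10 ∷ 10 ∷ [])
    ∷ (11 ∷ 11 ∷ 11 ∷ 11 ∷ 11 ∷ 11 ∷ 11 ∷ 11 ∷ 11 ∷ 11 ∷ 11 ∷ 11 ∷ 11 ∷ 11 ∷ 11 ∷ 11 ∷ [])
    ∷ (12 ∷ 12 ∷ 12 ∷ 12 ∷ 12 ∷ 12 ∷ 12 ∷ 12 ∷ 12 ∷ 12 ∷ 12 ∷ 12 ∷ 12 ∷ 12 ∷ 12 ∷ 12 ∷ [])
    ∷ (13 ∷ 13 ∷ 13 ∷ 13 ∷ 13 ∷ 13 ∷ 13 ∷ 13 ∷ 13 ∷ 13 ∷ 13 ∷ 13 ∷ 13 ∷ 13 ∷ 13 ∷ 13 ∷ [])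
    ∷ (14 ∷ 14 ∷ 14 ∷ 14 ∷ 14 ∷ 14 ∷ 14 ∷ 14 ∷ 14 ∷ 14 ∷ 14 ∷ 14 ∷ 14 ∷ 14 ∷ 14 ∷ 14 ∷ [])
    ∷ (15 ∷ 15 ∷ 15 ∷ 15 ∷ 15 ∷ 15 ∷ 15 ∷ 15 ∷ 15 ∷ 15 ∷ 15 ∷ 15 ∷ 15 ∷ 15 ∷ 15 ∷ 15 ∷ [])
    ∷ []

  update-table : Vec (Vec (Fin 16) 16) 16
  update-table =
      ( 0 ∷  1 ∷  2 ∷  3 ∷  0 ∷  0 ∷  1 ∷  1 ∷  0 ∷  0 ∷  1 ∷  1 ∷  2 ∷  2 ∷  3 ∷  3 ∷ [])
    ∷ ( 0 ∷  1 ∷  2 ∷  3 ∷  0 ∷  0 ∷  1 ∷  1 ∷  0 ∷  0 ∷  1 ∷  1 ∷  2 ∷  2 ∷  3 ∷  3 ∷ [])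
    ∷ ( 0 ∷  1 ∷  2 ∷  3 ∷  2 ∷  3 ∷  3 ∷  2 ∷  0 ∷  0 ∷  1 ∷  1 ∷  2 ∷  2 ∷  3 ∷  3 ∷ [])
    ∷ ( 0 ∷  1 ∷  2 ∷  3 ∷  2 ∷  3 ∷  3 ∷  2 ∷  0 ∷  0 ∷  1 ∷  1 ∷  2 ∷  2 ∷  3 ∷  3 ∷ [])
    ∷ ( 4 ∷  6 ∷  4 ∷  6 ∷  4 ∷  5 ∷  6 ∷  7 ∷  4 ∷  5 ∷  6 ∷  7 ∷  4 ∷  7 ∷  5 ∷  6 ∷ [])
    ∷ ( 5 ∷  7 ∷  7 ∷  5 ∷  4 ∷  5 ∷  6 ∷  7 ∷  4 ∷  5 ∷  6 ∷  7 ∷  4 ∷  7 ∷  5 ∷  6 ∷ [])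
    ∷ ( 4 ∷  6 ∷  4 ∷  6 ∷  4 ∷  5 ∷  6 ∷  7 ∷  4 ∷  5 ∷  6 ∷  7 ∷  4 ∷  7 ∷  5 ∷  6 ∷ [])
    ∷ ( 5 ∷  7 ∷  7 ∷  5 ∷  4 ∷  5 ∷  6 ∷  7 ∷  4 ∷  5 ∷  6 ∷  7 ∷  4 ∷  7 ∷  5 ∷  6 ∷ [])
    ∷ ( 8 ∷ 10 ∷ 12 ∷ 15 ∷  8 ∷  9 ∷ 10 ∷ 11 ∷  8 ∷  9 ∷ 10 ∷ 11 ∷ 12 ∷ 13 ∷ 14 ∷ 15 ∷ [])
    ∷ ( 9 ∷ 11 ∷ 13 ∷ 14 ∷  8 ∷  9 ∷ 10 ∷ 11 ∷  8 ∷  9 ∷ 10 ∷ 11 ∷ 12 ∷ 13 ∷ 14 ∷ 15 ∷ [])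
    ∷ ( 8 ∷ 10 ∷ 12 ∷ 15 ∷  8 ∷  9 ∷ 10 ∷ 11 ∷  8 ∷  9 ∷ 10 ∷ 11 ∷ 12 ∷ 13 ∷ 14 ∷ 15 ∷ [])
    ∷ ( 9 ∷ 11 ∷ 13 ∷ 14 ∷  8 ∷  9 ∷ 10 ∷ 11 ∷  8 ∷  9 ∷ 10 ∷ 11 ∷ 12 ∷ 13 ∷ 14 ∷ 15 ∷ [])
    ∷ ( 8 ∷ 10 ∷ 12 ∷ 15 ∷ 12 ∷ 14 ∷ 15 ∷ 13 ∷  8 ∷  9 ∷ 10 ∷ 11 ∷ 12 ∷ 13 ∷ 14 ∷ 15 ∷ [])
    ∷ ( 9 ∷ 11 ∷ 13 ∷ 14 ∷ 12 ∷ 14 ∷ 15 ∷ 13 ∷  8 ∷  9 ∷ 10 ∷ 11 ∷ 12 ∷ 13 ∷ 14 ∷ 15 ∷ [])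
    ∷ ( 9 ∷ 11 ∷ 13 ∷ 14 ∷ 12 ∷ 14 ∷ 15 ∷ 13 ∷  8 ∷  9 ∷ 10 ∷ 11 ∷ 12 ∷ 13 ∷ 14 ∷ 15 ∷ [])
    ∷ ( 8 ∷ 10 ∷ 12 ∷ 15 ∷ 12 ∷ 14 ∷ 15 ∷ 13 ∷  8 ∷  9 ∷ 10 ∷ 11 ∷ 12 ∷ 13 ∷ 14 ∷ 15 ∷ [])
    ∷ []

  infixl 6 _⊔ᶜ_
  infixl 9 _[_]ᶜ

  _⊔ᶜ_ _[_]ᶜ : Fin 16 → Fin 16 → Fin 16
  x ⊔ᶜ y   = lookup (lookup override-table x) y
  x [ y ]ᶜ = lookup (lookup update-table x) y

  laws : Laws _⊔ᶜ_ _[_]ᶜ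
  laws = record
    { law1    = toWitness {a? = all? λ x → all? λ y → x ≟ x [ x ⊔ᶜ y ]ᶜ} _
    ; law2    = toWitness {a? = all? λ x → all? λ y → x ⊔ᶜ y ≟ y [ x ]ᶜ ⊔ᶜ x} _
    ; law3    = toWitness {a? = all? λ x → all? λ y → all? λ z → x [ y ]ᶜ [ z ]ᶜ ≟ x [ z ⊔ᶜ y ]ᶜ} _
    ; law4    = toWitness {a? = all? λ x → all? λ y → all? λ z → (x ⊔ᶜ y) [ z ]ᶜ ≟ x [ z ]ᶜ ⊔ᶜ y [ z ]ᶜ} _
    ; ⊔-assoc = toWitness {a? = all? λ x → all? λ y → all? λ z → x ⊔ᶜ y ⊔ᶜ z ≟ x ⊔ᶜ (y ⊔ᶜ z)} _
    ; ⊔-idem  = toWitness {a? = all? λ x → x ⊔ᶜ x ≟ x} _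
    }

  fails : Fails _⊔ᶜ_ _[_]ᶜ
  fails = 0 , 4 , 13 , λ ()

open PointwiseUpdate using (update-identity)
open Counterexample using (_⊔ᶜ_; _[_]ᶜ; laws; fails)

mainTheorem7 :
    ((X Y : Set) → X → Y → (x y z : PFun X Y) →
       (x [ y [ x [ z ] ] ]) ≐ (x [ (y [ x ]) [ z ] ]))
    × (∃[ A ] Σ (A → A → A) λ _⊔'_ → Σ (A → A → A) λ _[_]' →
         Laws _⊔'_ _[_]' × Fails _⊔'_ _[_]')
mainTheorem7 = (λ X Y _ _ → update-identity) , (Fin 16 , _⊔ᶜ_ , _[_]ᶜ , laws , fails)
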